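{- Suppose there exists an $(n,r,s)$-system with independence number at most $\alpha$. Then for every integer $r'$ with $s+1\le r'\le r$ there exists an $(n,r',s)$-system with independence number at most $\alpha$.
   Context: An $r$-uniform hypergraph ($r$-graph) $\mathcal{H}$ is a family of $r$-subsets of a finite vertex set $V(\mathcal{H})$. A set $I\subset V(\mathcal{H})$ is independent if it contains no edge of $\mathcal{H}$; the independence number $\alpha(\mathcal{H})$ is the maximum size of an independent set. For integers $n\ge r\ge s\ge 1$, an $(n,r,s)$-system is an $r$-graph on $n$ vertices in which every pair of distinct edges has intersection of size less than $s$. -}

module Defs where

open import Data.Nat using (ℕ; _≤_; _<_)
open import Data.Fin using (Fin)
open import Data.Fin.Subset using (Subset; ∣_∣; _⊆_; _∩_)
open import Data.List using (List; length; lookup)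
open import Data.Product using (_×_)
open import Relation.Binary.PropositionalEquality using (_≡_)
open import Relation.Nullary using (¬_)
open import Data.List.Membership.Propositional using (_∈_)

Hypergraph : ℕ → Set
Hypergraph n = List (Subset n)

Uniform : ∀ {n} → ℕ → Hypergraph n → Set
Uniform r H = ∀ e → e ∈ H → ∣ e ∣ ≡ r

-- any two edges at distinct positions of the list meet in fewer than s vertices
-- (since s ≤ r, this also forces the edges to be pairwise distinct, i.e. H is a set)
SmallIntersections : ∀ {n} → ℕ → Hypergraph n → Set
SmallIntersections s H =
  ∀ i j → ¬ (i ≡ j) → ∣ lookup H i ∩ lookup H j ∣ < s

IsSystem : (n r s : ℕ) → Hypergraph n → Set
IsSystem n r s H = Uniform r H × SmallIntersections s H

Independent : ∀ {n} → Hypergraph n → Subset n → Set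
Independent H I = ∀ e → e ∈ H → ¬ (e ⊆ I)

IndepNumAtMost : ∀ {n} → Hypergraph n → ℕ → Set
IndepNumAtMost H a = ∀ I → Independent H I → ∣ I ∣ ≤ a

{-# OPTIONS --safe #-}
module Submission where

-- Replace every edge e of H by an r′-subset of e. Intersections of edges
-- can only shrink, so the new r′-graph is again a system with intersections
-- below s; and every new edge lies in an old one, so a set independent in the
-- new graph is independent in H, and α does not grow.

open import Defs
open import Data.Nat using (ℕ; _≤_; _<_; suc; zero; s≤s)
open import Data.Nat.Properties using (≤-trans; ≤-reflexive)
open import Data.Product using (Σ; _×_; _,_)
import Data.Fin as Fin
open import Data.Vec using ([]; _∷_)
open import Data.Bool using (true; false)
open import Data.Fin.Subset using (Subset; ∣_∣; _⊆_; _∩_; ⊥; inside; outside)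
open import Data.Fin.Subset.Properties
  using (p⊆q⇒∣p∣≤∣q∣; x∈p∩q⁺; x∈p∩q⁻; ⊆-trans; ⊥⊆; ∣⊥∣≡0; out⊆; in⊆in)
open import Data.List using (List; _∷_; map; lookup)
open import Data.List.Membership.Propositional.Properties using (∈-map⁻; ∈-map⁺)
open import Relation.Binary.PropositionalEquality using (_≡_; _≢_; refl; sym; cong)

∩-mono-⊆ : ∀ {n} {p p′ q q′ : Subset n} → p ⊆ p′ → q ⊆ q′ → p ∩ q ⊆ p′ ∩ q′
∩-mono-⊆ {p = p} {q = q} p⊆p′ q⊆q′ x∈p∩q with x∈p∩q⁻ p q x∈p∩q
... | x∈p , x∈q = x∈p∩q⁺ (p⊆p′ x∈p , q⊆q′ x∈q)

takeSubset : ∀ {n} → ℕ → Subset n → Subset n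
takeSubset zero    p           = ⊥
takeSubset (suc k) []          = []
takeSubset (suc k) (true ∷ p)  = inside ∷ takeSubset k p
takeSubset (suc k) (false ∷ p) = outside ∷ takeSubset (suc k) p

takeSubset-⊆ : ∀ {n} k (p : Subset n) → takeSubset k p ⊆ p
takeSubset-⊆ zero    p           = ⊥⊆
takeSubset-⊆ (suc k) []          = λ ()
takeSubset-⊆ (suc k) (true ∷ p)  = in⊆in (takeSubset-⊆ k p)
takeSubset-⊆ (suc k) (false ∷ p) = out⊆ (takeSubset-⊆ (suc k) p)

∣takeSubset∣≡ : ∀ {n} k (p : Subset n) → k ≤ ∣ p ∣ → ∣ takeSubset k p ∣ ≡ k
∣takeSubset∣≡ {n} zero p _                 = ∣⊥∣≡0 n
∣takeSubset∣≡ (suc k) (true ∷ p) (s≤s k≤∣p∣) = cong suc (∣takeSubset∣≡ k p k≤∣p∣)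
∣takeSubset∣≡ (suc k) (false ∷ p) k<∣p∣      = ∣takeSubset∣≡ (suc k) p k<∣p∣

Pairwise : {A : Set} → (A → A → Set) → List A → Set
Pairwise R xs = ∀ i j → i ≢ j → R (lookup xs i) (lookup xs j)

All-lookup-map : {A B : Set} {P : A → Set} {Q : B → Set} (f : A → B) →
  (∀ {x} → P x → Q (f x)) →
  ∀ xs → (∀ i → P (lookup xs i)) → ∀ i → Q (lookup (map f xs) i)
All-lookup-map f f-resp (x ∷ xs) P-xs Fin.zero    = f-resp (P-xs Fin.zero)
All-lookup-map {P = P} {Q} f f-resp (x ∷ xs) P-xs (Fin.suc i) =
  All-lookup-map {P = P} {Q} f f-resp xs (λ i′ → P-xs (Fin.suc i′)) i

Pairwise-map : {A B : Set} {R : A → A → Set} {S : B → B → Set} (f : A → B) →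
  (∀ {x y} → R x y → S (f x) (f y)) →
  ∀ xs → Pairwise R xs → Pairwise S (map f xs)
Pairwise-map f f-resp (x ∷ xs) R-xs Fin.zero Fin.zero 0≢0 with () ← 0≢0 refl
Pairwise-map {R = R} {S} f f-resp (x ∷ xs) R-xs Fin.zero (Fin.suc j) _ =
  All-lookup-map {P = R x} {Q = S (f x)} f f-resp xs (λ j′ → R-xs Fin.zero (Fin.suc j′) λ ()) j
Pairwise-map {R = R} {S} f f-resp (x ∷ xs) R-xs (Fin.suc i) Fin.zero _ =
  All-lookup-map {P = λ y → R y x} {Q = λ z → S z (f x)} f f-resp xs
    (λ i′ → R-xs (Fin.suc i′) Fin.zero λ ()) i
Pairwise-map {R = R} {S} f f-resp (x ∷ xs) R-xs (Fin.suc i) (Fin.suc j) i≢j =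
  Pairwise-map {R = R} {S} f f-resp xs
    (λ i′ j′ i′≢j′ → R-xs (Fin.suc i′) (Fin.suc j′) λ { refl → i′≢j′ refl })
    i j λ { refl → i≢j refl }

module Shrinking {n : ℕ} (f : Subset n → Subset n) (f-⊆ : ∀ p → f p ⊆ p) where

  SmallIntersections-map : ∀ {s} H → SmallIntersections s H → SmallIntersections s (map f H)
  SmallIntersections-map {s} = Pairwise-map {R = MeetBelow} {S = MeetBelow} f λ {p} {q} ∣p∩q∣<s →
    ≤-trans (s≤s (p⊆q⇒∣p∣≤∣q∣ (∩-mono-⊆ (f-⊆ p) (f-⊆ q)))) ∣p∩q∣<s
    where
    MeetBelow : Subset n → Subset n → Set
    MeetBelow p q = ∣ p ∩ q ∣ < s

  Independent-map : ∀ H I → Independent (map f H) I → Independent H I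
  Independent-map H I indep e e∈H e⊆I = indep (f e) (∈-map⁺ f e∈H) (⊆-trans (f-⊆ e) e⊆I)

  IndepNumAtMost-map : ∀ H {a} → IndepNumAtMost H a → IndepNumAtMost (map f H) a
  IndepNumAtMost-map H α≤a I indep = α≤a I (Independent-map H I indep)

Uniform-map-takeSubset : ∀ {n r} r′ (H : Hypergraph n) → r′ ≤ r →
  Uniform r H → Uniform r′ (map (takeSubset r′) H)
Uniform-map-takeSubset r′ H r′≤r uniform e e∈ with ∈-map⁻ (takeSubset r′) e∈
... | e₀ , e₀∈H , refl = ∣takeSubset∣≡ r′ e₀ (≤-trans r′≤r (≤-reflexive (sym (uniform e₀ e₀∈H))))

proposition2p2 : (n r s a : ℕ) → 1 ≤ s → s ≤ r → r ≤ n →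
    Σ (Hypergraph n) (λ H → IsSystem n r s H × IndepNumAtMost H a) →
    (r′ : ℕ) → suc s ≤ r′ → r′ ≤ r →
    Σ (Hypergraph n) (λ H′ → IsSystem n r′ s H′ × IndepNumAtMost H′ a)
proposition2p2 n r s a _ _ _ (H , (uniform , small) , α≤a) r′ _ r′≤r =
  map (takeSubset r′) H ,
  (Uniform-map-takeSubset r′ H r′≤r uniform , SmallIntersections-map H small) ,
  IndepNumAtMost-map H α≤a
  where open Shrinking (takeSubset r′) (takeSubset-⊆ r′)
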